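{- For every integer $n\ge1$, $$P_n(x)=(1+x^2)P_{n-1}(x)+\binom{n-1}{\lfloor (n-1)/2\rfloor}(1-x)x^{n}.$$
   Context: For $0\le k\le n$ let $\mathcal{B}(n,k)=\binom{n}{\lfloor (n-k)/2\rfloor}$, and let the $n$th Pascalian polynomial be $P_n(x)=\sum_{k=0}^n\mathcal{B}(n,k)x^{n-k}$ (so $P_0(x)=1$). Note $\mathcal{B}(n-1,0)=\binom{n-1}{\lfloor (n-1)/2\rfloor}$. -}

module Defs where

open import Level using (Level)
open import Data.Nat using (ℕ; zero; suc; _∸_; _/_)
open import Data.Nat.Combinatorics using (_C_)
open import Algebra.Bundles using (CommutativeRing)

𝓑 : ℕ → ℕ → ℕ
𝓑 n k = n C ((n ∸ k) / 2)

module _ {c ℓ : Level} (R : CommutativeRing c ℓ) where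
  open CommutativeRing R

  ι : ℕ → Carrier
  ι zero = 0#
  ι (suc m) = 1# + ι m

  pow : Carrier → ℕ → Carrier
  pow x zero = 1#
  pow x (suc m) = x * pow x m

  sumTo : (ℕ → Carrier) → ℕ → Carrier
  sumTo f zero = f 0
  sumTo f (suc m) = sumTo f m + f (suc m)

  P : ℕ → Carrier → Carrier
  P n x = sumTo (λ k → ι (𝓑 n k) * pow x (n ∸ k)) n

module Submission where

open import Defs
open import Level using (Level)
open import Data.Nat using (ℕ; _∸_; _≤_)
open import Algebra.Bundles using (CommutativeRing)

open import Data.Nat as ℕ using (zero; suc; _/_; ⌊_/2⌋; ⌈_/2⌉)
open import Data.Nat.Properties using (⌊n/2⌋+⌈n/2⌉≡n; ⌊n/2⌋≤n; m+n∸m≡n)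
open import Data.Nat.DivMod using (m/n≡1+[m∸n]/n)
open import Data.Nat.Combinatorics using (_C_; nCk≡nC[n∸k]; nCk+nC[k+1]≡[n+1]C[k+1])
open import Relation.Binary.PropositionalEquality as ≡ using (_≡_)
import Relation.Binary.Reasoning.Setoid as SetoidReasoning

-- Reversing the sum, P n x = Σ_{j ≤ n} C(n, ⌊j/2⌋) x^j.  Pascal's rule on the
-- coefficients C(n+1, ⌊j/2⌋) = C(n, ⌊j/2⌋) + C(n, ⌊j/2⌋ - 1) splits P (n+1) x
-- into P n x extended by one term, plus x² times P n x shortened by one term.
-- The two boundary terms are C(n, ⌈n/2⌉) x^(n+1) and C(n, ⌊n/2⌋) x^(n+2), and
-- the central binomial coefficients agree, leaving C(n, ⌊n/2⌋)(1 - x) x^(n+1).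

n/2≡⌊n/2⌋ : ∀ n → n / 2 ≡ ⌊ n /2⌋
n/2≡⌊n/2⌋ zero          = ≡.refl
n/2≡⌊n/2⌋ (suc zero)    = ≡.refl
n/2≡⌊n/2⌋ (suc (suc n)) =
  ≡.trans (m/n≡1+[m∸n]/n {suc (suc n)} {2} (ℕ.s≤s (ℕ.s≤s ℕ.z≤n))) (≡.cong suc (n/2≡⌊n/2⌋ n))

nC⌈n/2⌉≡nC⌊n/2⌋ : ∀ n → n C ⌈ n /2⌉ ≡ n C ⌊ n /2⌋
nC⌈n/2⌉≡nC⌊n/2⌋ n = ≡.sym (begin
  n C ⌊ n /2⌋                         ≡⟨ nCk≡nC[n∸k] (⌊n/2⌋≤n n) ⟩
  n C (n ∸ ⌊ n /2⌋)                   ≡⟨ ≡.cong (λ m → n C (m ∸ ⌊ n /2⌋)) (≡.sym (⌊n/2⌋+⌈n/2⌉≡n n)) ⟩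
  n C (⌊ n /2⌋ ℕ.+ ⌈ n /2⌉ ∸ ⌊ n /2⌋) ≡⟨ ≡.cong (n C_) (m+n∸m≡n ⌊ n /2⌋ ⌈ n /2⌉) ⟩
  n C ⌈ n /2⌉                         ∎)
  where open ≡.≡-Reasoning

module _ {c ℓ : Level} (R : CommutativeRing c ℓ) where
  open CommutativeRing R
  open SetoidReasoning setoid
  open import Algebra.Solver.Ring.NaturalCoefficients.Default commutativeSemiring
    using (solve; _:=_; _:+_; _:*_; con)

  ι-homo-+ : ∀ m n → ι R (m ℕ.+ n) ≈ ι R m + ι R n
  ι-homo-+ zero    n = sym (+-identityˡ _)
  ι-homo-+ (suc m) n = trans (+-congˡ (ι-homo-+ m n)) (sym (+-assoc _ _ _))

  sumTo-cong : ∀ {f g} → (∀ k → f k ≈ g k) → ∀ n → sumTo R f n ≈ sumTo R g n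
  sumTo-cong f≈g zero    = f≈g 0
  sumTo-cong f≈g (suc n) = +-cong (sumTo-cong f≈g n) (f≈g (suc n))

  sumTo-split-head : ∀ f n → sumTo R f (suc n) ≈ f 0 + sumTo R (λ k → f (suc k)) n
  sumTo-split-head f zero    = refl
  sumTo-split-head f (suc n) = begin
    sumTo R f (suc n) + f (suc (suc n))                    ≈⟨ +-congʳ (sumTo-split-head f n) ⟩
    (f 0 + sumTo R (λ k → f (suc k)) n) + f (suc (suc n))  ≈⟨ +-assoc _ _ _ ⟩
    f 0 + sumTo R (λ k → f (suc k)) (suc n)                ∎

  sumTo-reverse : ∀ f n → sumTo R (λ k → f (n ∸ k)) n ≈ sumTo R f n
  sumTo-reverse f zero    = refl
  sumTo-reverse f (suc n) = begin
    sumTo R (λ k → f (suc n ∸ k)) (suc n)    ≈⟨ sumTo-split-head (λ k → f (suc n ∸ k)) n ⟩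
    f (suc n) + sumTo R (λ k → f (n ∸ k)) n  ≈⟨ +-congˡ (sumTo-reverse f n) ⟩
    f (suc n) + sumTo R f n                  ≈⟨ +-comm _ _ ⟩
    sumTo R f (suc n)                        ∎

  module _ (x : Carrier) where

    term : ℕ → ℕ → Carrier
    term n j = ι R (n C ⌊ j /2⌋) * pow R x j

    partialSum : ℕ → ℕ → Carrier
    partialSum n = sumTo R (term n)

    P≈partialSum : ∀ n → P R n x ≈ partialSum n n
    P≈partialSum n = begin
      P R n x                                            ≈⟨ sumTo-reverse (λ j → ι R (n C (j / 2)) * pow R x j) n ⟩
      sumTo R (λ j → ι R (n C (j / 2)) * pow R x j) n    ≈⟨ sumTo-cong (λ j → *-congʳ (reflexive (≡.cong (λ i → ι R (n C i)) (n/2≡⌊n/2⌋ j)))) n ⟩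
      partialSum n n                                     ∎

    term-pascal : ∀ n j → term (suc n) (suc (suc j)) ≈ x * x * term n j + term n (suc (suc j))
    term-pascal n j = begin
      ι R (suc n C suc h) * (x * (x * pow R x j))
        ≈⟨ *-congʳ (reflexive (≡.cong (ι R) (≡.sym (nCk+nC[k+1]≡[n+1]C[k+1] n h)))) ⟩
      ι R (n C h ℕ.+ n C suc h) * (x * (x * pow R x j))
        ≈⟨ *-congʳ (ι-homo-+ (n C h) (n C suc h)) ⟩
      (ι R (n C h) + ι R (n C suc h)) * (x * (x * pow R x j))
        ≈⟨ solve 4 (λ a b y p → (a :+ b) :* (y :* (y :* p)) := (y :* y :* (a :* p) :+ b :* (y :* (y :* p))))
             refl (ι R (n C h)) (ι R (n C suc h)) x (pow R x j) ⟩
      x * x * term n j + term n (suc (suc j)) ∎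
      where h = ⌊ j /2⌋

    -- The summand x² · term n k on the left stands in for a subtraction.
    partialSum-pascal : ∀ n k →
      partialSum (suc n) (suc k) + x * x * term n k ≈ partialSum n (suc k) + x * x * partialSum n k
    partialSum-pascal n zero    = refl
    partialSum-pascal n (suc k) = begin
      partialSum (suc n) (suc k) + term (suc n) (suc (suc k)) + x * x * term n (suc k)
        ≈⟨ +-congʳ (+-congˡ (term-pascal n k)) ⟩
      partialSum (suc n) (suc k) + (x * x * term n k + term n (suc (suc k))) + x * x * term n (suc k)
        ≈⟨ solve 5 (λ s y a b d → (s :+ (y :* y :* a :+ b) :+ y :* y :* d) := (s :+ y :* y :* a :+ b :+ y :* y :* d))
             refl (partialSum (suc n) (suc k)) x (term n k) (term n (suc (suc k))) (term n (suc k)) ⟩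
      partialSum (suc n) (suc k) + x * x * term n k + term n (suc (suc k)) + x * x * term n (suc k)
        ≈⟨ +-congʳ (+-congʳ (partialSum-pascal n k)) ⟩
      partialSum n (suc k) + x * x * partialSum n k + term n (suc (suc k)) + x * x * term n (suc k)
        ≈⟨ solve 5 (λ s t y b d → (s :+ y :* y :* t :+ b :+ y :* y :* d) := (s :+ b :+ y :* y :* (t :+ d)))
             refl (partialSum n (suc k)) (partialSum n k) x (term n (suc (suc k))) (term n (suc k)) ⟩
      partialSum n (suc (suc k)) + x * x * partialSum n (suc k) ∎

    partialSum-recurrence : ∀ n →
      partialSum (suc n) (suc n)
        ≈ (1# + x * x) * partialSum n n + (ι R (n C ⌊ n /2⌋) * (1# - x)) * pow R x (suc n)
    partialSum-recurrence n = begin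
      S′                                    ≈⟨ sym (+-identityʳ S′) ⟩
      S′ + 0#                               ≈⟨ +-congˡ (sym x-x≈0) ⟩
      S′ + a * ((x + - x) * (x * p))
        ≈⟨ solve 5 (λ s a y z p → (s :+ a :* ((y :+ z) :* (y :* p))) := (s :+ y :* y :* (a :* p) :+ a :* (z :* (y :* p))))
             refl S′ a x (- x) p ⟩
      S′ + x * x * (a * p) + a * (- x * (x * p))
        ≈⟨ +-congʳ pascal ⟩
      Q + a * (x * p) + x * x * Q + a * (- x * (x * p))
        ≈⟨ solve 5 (λ q a y z p → (q :+ a :* (y :* p) :+ y :* y :* q :+ a :* (z :* (y :* p)))
                                   := ((con 1 :+ y :* y) :* q :+ (a :* (con 1 :+ z)) :* (y :* p)))
             refl Q a x (- x) p ⟩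
      (1# + x * x) * Q + (a * (1# - x)) * (x * p) ∎
      where
        S′ = partialSum (suc n) (suc n)
        Q  = partialSum n n
        a  = ι R (n C ⌊ n /2⌋)
        p  = pow R x n

        x-x≈0 : a * ((x + - x) * (x * p)) ≈ 0#
        x-x≈0 = trans (*-congˡ (trans (*-congʳ (-‿inverseʳ x)) (zeroˡ _))) (zeroʳ a)

        pascal : S′ + x * x * (a * p) ≈ Q + a * (x * p) + x * x * Q
        pascal = trans (partialSum-pascal n n)
          (+-congʳ (+-congˡ (*-congʳ (reflexive (≡.cong (ι R) (nC⌈n/2⌉≡nC⌊n/2⌋ n))))))

proposition3p2 : {c ℓ : Level} (R : CommutativeRing c ℓ) (n : ℕ) → 1 ≤ n →
    (x : CommutativeRing.Carrier R) →
    CommutativeRing._≈_ R (P R n x)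
      (CommutativeRing._+_ R
        (CommutativeRing._*_ R
          (CommutativeRing._+_ R (CommutativeRing.1# R) (CommutativeRing._*_ R x x))
          (P R (n ∸ 1) x))
        (CommutativeRing._*_ R
          (CommutativeRing._*_ R (ι R (𝓑 (n ∸ 1) 0))
            (CommutativeRing._-_ R (CommutativeRing.1# R) x))
          (pow R x n)))
proposition3p2 R (suc n) _ x = begin
  P R (suc n) x                     ≈⟨ P≈partialSum R x (suc n) ⟩
  partialSum R x (suc n) (suc n)    ≈⟨ partialSum-recurrence R x n ⟩
  (1# + x * x) * partialSum R x n n + (ι R (n C ⌊ n /2⌋) * (1# - x)) * pow R x (suc n)
    ≈⟨ +-cong (*-congˡ (sym (P≈partialSum R x n)))
              (*-congʳ (*-congʳ (reflexive (≡.cong (λ i → ι R (n C i)) (≡.sym (n/2≡⌊n/2⌋ n)))))) ⟩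
  (1# + x * x) * P R n x + (ι R (𝓑 n 0) * (1# - x)) * pow R x (suc n) ∎
  where
    open CommutativeRing R
    open SetoidReasoning setoid
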